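{- Let $n$ be an even integer ($n\ge 4$), let $B=\{v\in V(C_n\square K_2): x_v+y_v\equiv 1\pmod 2\}$ and $A=V(C_n\square K_2)\setminus B$. If $v,w\in A$ satisfy $d_{C_n}(x_v,x_w)\equiv 1\pmod 4$, then there exists $s\in B$ such that $d(v,s)=d(w,s)$.
   Context: $C_n$ is the cycle with vertex set $[n]=\{1,\dots,n\}$, where $i$ is adjacent to $i+1$ for $1\le i<n$ and $n$ is adjacent to $1$; $K_2$ has vertex set $\{1,2\}$. The Cartesian product $C_n\square K_2$ has vertex set $[n]\times\{1,2\}$, with $(g,h)\sim(g',h')$ iff either $g=g'$ and $hh'$ is an edge of $K_2$, or $h=h'$ and $gg'\in E(C_n)$. A vertex $v$ is written $v=(x_v,y_v)$. $d$ denotes the shortest-path distance in $C_n\square K_2$. -}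

module Defs where

open import Data.Nat using (ℕ; zero; suc; _+_; _≤_; _%_)
open import Data.Product using (_×_; _,_; proj₁; proj₂)
open import Data.Sum using (_⊎_)
open import Relation.Binary.PropositionalEquality using (_≡_)

data Walk {A : Set} (Adj : A → A → Set) : A → A → ℕ → Set where
  nil  : ∀ {u} → Walk Adj u u 0
  cons : ∀ {u v w k} → Adj u v → Walk Adj v w k → Walk Adj u w (suc k)

IsDist : {A : Set} → (A → A → Set) → A → A → ℕ → Set
IsDist Adj u v k = Walk Adj u v k × (∀ m → Walk Adj u v m → k ≤ m)

InCycle : ℕ → ℕ → Set
InCycle n i = 1 ≤ i × i ≤ n

CAdj : ℕ → ℕ → ℕ → Set
CAdj n i j = InCycle n i × InCycle n j ×
  (j ≡ suc i ⊎ i ≡ suc j ⊎ (i ≡ n × j ≡ 1) ⊎ (i ≡ 1 × j ≡ n))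

KAdj : ℕ → ℕ → Set
KAdj h h' = (h ≡ 1 × h' ≡ 2) ⊎ (h ≡ 2 × h' ≡ 1)

InK2 : ℕ → Set
InK2 h = 1 ≤ h × h ≤ 2

Vtx : Set
Vtx = ℕ × ℕ

InV : ℕ → Vtx → Set
InV n (x , y) = InCycle n x × InK2 y

PAdj : ℕ → Vtx → Vtx → Set
PAdj n (g , h) (g' , h') =
  (g ≡ g' × InCycle n g × KAdj h h') ⊎ (h ≡ h' × InK2 h × CAdj n g g')

InB : ℕ → Vtx → Set
InB n v = InV n v × (proj₁ v + proj₂ v) % 2 ≡ 1

InA : ℕ → Vtx → Set
InA n v = InV n v × (proj₁ v + proj₂ v) % 2 ≡ 0

-- Colour the vertex (x , y) by the parity of x + y; since n is even, C_n □ K_2 is bipartite for this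
-- colouring, A and B being its colour classes. Write k = 4j + 1 = h + (h + 1) with h = 2j even, split
-- a geodesic from x_v to x_w at the point c with d(x_v, c) = h, and put s = (c , y_w). The walk from w
-- to s along the layer y_w has odd length h + 1, so s ∈ B; the walk from (x_v , y_w) to s has even
-- length h, so (x_v , y_w) ∈ B, i.e. y_v ≠ y_w. Distances in the product add up: d(v, s) = 1 + h and
-- d(w, s) = h + 1.
module Submission where

open import Defs
open import Data.Nat using (ℕ; zero; suc; _+_; _*_; _/_; _≤_; _<_; _%_; z≤n; s≤s; parity)
open import Data.Nat.Properties using (≤-trans; n≤1+n; +-suc; +-identityʳ; +-cancelˡ-≤; +-cancelʳ-≤)
open import Data.Nat.DivMod using (m≡m%n+[m/n]*n)
open import Data.Nat.Tactic.RingSolver using (solve-∀)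
open import Data.Parity.Base as ℙ using (0ℙ; 1ℙ)
open import Data.Parity.Properties using (+-homo-+; *-homo-*)
open import Data.Product using (Σ; _×_; _,_; proj₁; proj₂)
open import Data.Sum using (_⊎_; inj₁; inj₂)
open import Data.Empty using (⊥-elim)
open import Relation.Binary.Definitions using (Symmetric)
open import Relation.Binary.PropositionalEquality using (_≡_; _≢_; refl; sym; trans; cong; subst)
open Relation.Binary.PropositionalEquality.≡-Reasoning

module _ {A : Set} {Adj : A → A → Set} where

  _++ʷ_ : ∀ {u v w a b} → Walk Adj u v a → Walk Adj v w b → Walk Adj u w (a + b)
  nil      ++ʷ q = q
  cons e p ++ʷ q = cons e (p ++ʷ q)

  splitAtʷ : ∀ a {b u w} → Walk Adj u w (a + b) → Σ A λ c → Walk Adj u c a × Walk Adj c w b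
  splitAtʷ zero    {u = u} p = u , nil , p
  splitAtʷ (suc a) (cons e p) with splitAtʷ a p
  ... | c , p₁ , p₂ = c , cons e p₁ , p₂

  reverseʷ : Symmetric Adj → ∀ {u v k} → Walk Adj u v k → Walk Adj v u k
  reverseʷ sym-adj {k = k} p = subst (Walk Adj _ _) (+-identityʳ k) (go p nil)
    where
    go : ∀ {u v w a b} → Walk Adj u v a → Walk Adj u w b → Walk Adj v w (a + b)
    go nil        r = r
    go {a = suc a} {b} (cons e p) r = subst (Walk Adj _ _) (+-suc a b) (go p (cons (sym-adj e) r))

  IsDist-sym : Symmetric Adj → ∀ {u v k} → IsDist Adj u v k → IsDist Adj v u k
  IsDist-sym sym-adj (p , minimal) = reverseʷ sym-adj p , λ m r → minimal m (reverseʷ sym-adj r)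

  IsDist-splitAt : ∀ a {b u w} → IsDist Adj u w (a + b) →
    Σ A λ c → IsDist Adj u c a × IsDist Adj c w b
  IsDist-splitAt a {b} (p , minimal) with splitAtʷ a p
  ... | c , p₁ , p₂ =
    c , (p₁ , λ m r → +-cancelʳ-≤ b a m (minimal _ (r ++ʷ p₂)))
      , (p₂ , λ m r → +-cancelˡ-≤ a b m (minimal _ (p₁ ++ʷ r)))

  walk-parity : (f : A → ℕ) → (∀ {u v} → Adj u v → parity (suc (f u)) ≡ parity (f v)) →
    ∀ {u v k} → Walk Adj u v k → parity (f u + k) ≡ parity (f v)
  walk-parity f step {u} nil = cong parity (+-identityʳ (f u))
  walk-parity f step {u} {v} {suc k} (cons {v = u′} e p) = begin
    parity (f u + suc k)            ≡⟨ cong parity (+-suc (f u) k) ⟩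
    parity (suc (f u) + k)          ≡⟨ +-homo-+ (suc (f u)) k ⟩
    parity (suc (f u)) ℙ.+ parity k ≡⟨ cong (ℙ._+ parity k) (step e) ⟩
    parity (f u′) ℙ.+ parity k      ≡⟨ +-homo-+ (f u′) k ⟨
    parity (f u′ + k)               ≡⟨ walk-parity f step p ⟩
    parity (f v)                    ∎

mapʷ : ∀ {A B : Set} {Adj : A → A → Set} {Adj′ : B → B → Set} (f : A → B) →
  (∀ {u v} → Adj u v → Adj′ (f u) (f v)) → ∀ {u v k} → Walk Adj u v k → Walk Adj′ (f u) (f v) k
mapʷ f hom nil        = nil
mapʷ f hom (cons e p) = cons (hom e) (mapʷ f hom p)

%2≡0⇒parity≡0ℙ : ∀ m → m % 2 ≡ 0 → parity m ≡ 0ℙ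
%2≡0⇒parity≡0ℙ zero          _  = refl
%2≡0⇒parity≡0ℙ (suc zero)    ()
%2≡0⇒parity≡0ℙ (suc (suc m)) eq = %2≡0⇒parity≡0ℙ m eq

parity≡1ℙ⇒%2≡1 : ∀ m → parity m ≡ 1ℙ → m % 2 ≡ 1
parity≡1ℙ⇒%2≡1 zero          ()
parity≡1ℙ⇒%2≡1 (suc zero)    _  = refl
parity≡1ℙ⇒%2≡1 (suc (suc m)) eq = parity≡1ℙ⇒%2≡1 m eq

%4≡1⇒≡2j+[1+2j] : ∀ k → k % 4 ≡ 1 → k ≡ 2 * (k / 4) + suc (2 * (k / 4))
%4≡1⇒≡2j+[1+2j] k k%4≡1 = begin
  k                                 ≡⟨ m≡m%n+[m/n]*n k 4 ⟩
  k % 4 + k / 4 * 4                 ≡⟨ cong (_+ k / 4 * 4) k%4≡1 ⟩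
  1 + k / 4 * 4                     ≡⟨ 1+4j≡2j+[1+2j] (k / 4) ⟩
  2 * (k / 4) + suc (2 * (k / 4))   ∎
  where
  1+4j≡2j+[1+2j] : ∀ j → 1 + j * 4 ≡ 2 * j + suc (2 * j)
  1+4j≡2j+[1+2j] = solve-∀

CAdj-sym : ∀ {n} → Symmetric (CAdj n)
CAdj-sym (i∈C , j∈C , inj₁ eq)                       = j∈C , i∈C , inj₂ (inj₁ eq)
CAdj-sym (i∈C , j∈C , inj₂ (inj₁ eq))                = j∈C , i∈C , inj₁ eq
CAdj-sym (i∈C , j∈C , inj₂ (inj₂ (inj₁ (i≡n , j≡1)))) = j∈C , i∈C , inj₂ (inj₂ (inj₂ (j≡1 , i≡n)))
CAdj-sym (i∈C , j∈C , inj₂ (inj₂ (inj₂ (i≡1 , j≡n)))) = j∈C , i∈C , inj₂ (inj₂ (inj₁ (j≡n , i≡1)))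

walk-target-InCycle : ∀ {n i j k} → InCycle n i → Walk (CAdj n) i j k → InCycle n j
walk-target-InCycle i∈C nil                     = i∈C
walk-target-InCycle _   (cons (_ , v∈C , _) p) = walk-target-InCycle v∈C p

CAdj-parity : ∀ {n i j} → parity n ≡ 0ℙ → CAdj n i j → parity (suc i) ≡ parity j
CAdj-parity _ (_ , _ , inj₁ refl)        = refl
CAdj-parity _ (_ , _ , inj₂ (inj₁ refl)) = refl
CAdj-parity {n} n-even (_ , _ , inj₂ (inj₂ (inj₁ (refl , refl)))) =
  trans (+-homo-+ 1 n) (cong (1ℙ ℙ.+_) n-even)
CAdj-parity n-even (_ , _ , inj₂ (inj₂ (inj₂ (refl , refl)))) = sym n-even

InK2-cases : ∀ {y} → InK2 y → y ≡ 1 ⊎ y ≡ 2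
InK2-cases (s≤s z≤n , s≤s z≤n)       = inj₁ refl
InK2-cases (s≤s z≤n , s≤s (s≤s z≤n)) = inj₂ refl

KAdj-of-≢ : ∀ {y y′} → InK2 y → InK2 y′ → y ≢ y′ → KAdj y y′
KAdj-of-≢ y∈K y′∈K y≢y′ with InK2-cases y∈K | InK2-cases y′∈K
... | inj₁ refl | inj₁ refl = ⊥-elim (y≢y′ refl)
... | inj₁ refl | inj₂ refl = inj₁ (refl , refl)
... | inj₂ refl | inj₁ refl = inj₂ (refl , refl)
... | inj₂ refl | inj₂ refl = ⊥-elim (y≢y′ refl)

weight : Vtx → ℕ
weight v = proj₁ v + proj₂ v

PAdj-parity : ∀ {n u u′} → parity n ≡ 0ℙ → PAdj n u u′ → parity (suc (weight u)) ≡ parity (weight u′)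
PAdj-parity {u = x , _} _ (inj₁ (refl , _ , inj₁ (refl , refl))) = cong parity (sym (+-suc x 1))
PAdj-parity {u = x , _} _ (inj₁ (refl , _ , inj₂ (refl , refl))) = cong (λ t → parity (suc t)) (+-suc x 1)
PAdj-parity {u = x , y} {x′ , _} n-even (inj₂ (refl , _ , e)) = begin
  parity (suc x + y)           ≡⟨ +-homo-+ (suc x) y ⟩
  parity (suc x) ℙ.+ parity y  ≡⟨ cong (ℙ._+ parity y) (CAdj-parity n-even e) ⟩
  parity x′ ℙ.+ parity y       ≡⟨ +-homo-+ x′ y ⟨
  parity (x′ + y)              ∎

InA-walk-parity : ∀ {n u u′ m} → parity n ≡ 0ℙ → InA n u → Walk (PAdj n) u u′ m →
  parity (weight u′) ≡ parity m
InA-walk-parity {u = u} {u′} {m} n-even (_ , u∈A) p = begin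
  parity (weight u′)             ≡⟨ walk-parity weight (PAdj-parity n-even) p ⟨
  parity (weight u + m)          ≡⟨ +-homo-+ (weight u) m ⟩
  parity (weight u) ℙ.+ parity m ≡⟨ cong (ℙ._+ parity m) (%2≡0⇒parity≡0ℙ (weight u) u∈A) ⟩
  parity m                       ∎

layerʷ : ∀ {n x x′ y k} → InK2 y → Walk (CAdj n) x x′ k → Walk (PAdj n) (x , y) (x′ , y) k
layerʷ y∈K = mapʷ (_, _) (λ e → inj₂ (refl , y∈K , e))

projectʷ : ∀ {n u u′ m} → Walk (PAdj n) u u′ m →
  Σ ℕ λ L → Walk (CAdj n) (proj₁ u) (proj₁ u′) L × L ≤ m × (proj₂ u ≢ proj₂ u′ → L < m)
projectʷ nil = 0 , nil , z≤n , λ y≢y → ⊥-elim (y≢y refl)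
projectʷ (cons (inj₁ (refl , _ , _)) p) with projectʷ p
... | L , c , L≤m , _ = L , c , ≤-trans L≤m (n≤1+n _) , λ _ → s≤s L≤m
projectʷ (cons (inj₂ (refl , _ , e)) p) with projectʷ p
... | L , c , L≤m , L<m = suc L , cons e c , s≤s L≤m , λ y≢y′ → s≤s (L<m y≢y′)

IsDist-sameLayer : ∀ {n x x′ y a} → InK2 y → IsDist (CAdj n) x x′ a → IsDist (PAdj n) (x , y) (x′ , y) a
IsDist-sameLayer {n} {x} {x′} {y} {a} y∈K (p , minimal) = layerʷ y∈K p , lower-bound
  where
  lower-bound : ∀ m → Walk (PAdj n) (x , y) (x′ , y) m → a ≤ m
  lower-bound m r with projectʷ r
  ... | L , c , L≤m , _ = ≤-trans (minimal L c) L≤m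

IsDist-otherLayer : ∀ {n x x′ y y′ a} → InCycle n x → InK2 y → InK2 y′ → y ≢ y′ →
  IsDist (CAdj n) x x′ a → IsDist (PAdj n) (x , y) (x′ , y′) (suc a)
IsDist-otherLayer {n} {x} {x′} {y} {y′} {a} x∈C y∈K y′∈K y≢y′ (p , minimal) =
  cons (inj₁ (refl , x∈C , KAdj-of-≢ y∈K y′∈K y≢y′)) (layerʷ y′∈K p) , lower-bound
  where
  lower-bound : ∀ m → Walk (PAdj n) (x , y) (x′ , y′) m → suc a ≤ m
  lower-bound m r with projectʷ r
  ... | L , c , _ , L<m = ≤-trans (s≤s (minimal L c)) (L<m y≢y′)

equidistant-vertex-in-B : ∀ {n xv yv xw yw} → parity n ≡ 0ℙ → InA n (xv , yv) → InA n (xw , yw) →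
  ∀ h → parity h ≡ 0ℙ → IsDist (CAdj n) xv xw (h + suc h) →
  Σ Vtx λ s → InB n s × (Σ ℕ λ m → IsDist (PAdj n) (xv , yv) s m × IsDist (PAdj n) (xw , yw) s m)
equidistant-vertex-in-B {n} {xv} {yv} {xw} {yw}
  n-even v∈A@((xv∈C , yv∈K) , _) w∈A@((_ , yw∈K) , _) h h-even geodesic
  with IsDist-splitAt h geodesic
... | c , xv→c , c→xw =
  (c , yw) , ((walk-target-InCycle xv∈C (proj₁ xv→c) , yw∈K) , parity≡1ℙ⇒%2≡1 (c + yw) s-odd) ,
  suc h , IsDist-otherLayer xv∈C yv∈K yw∈K yv≢yw xv→c , IsDist-sameLayer yw∈K xw→c
  where
  xw→c : IsDist (CAdj n) xw c (suc h)
  xw→c = IsDist-sym CAdj-sym c→xw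

  s-odd : parity (c + yw) ≡ 1ℙ
  s-odd = begin
    parity (c + yw)       ≡⟨ InA-walk-parity n-even w∈A (layerʷ yw∈K (proj₁ xw→c)) ⟩
    parity (1 + h)        ≡⟨ +-homo-+ 1 h ⟩
    1ℙ ℙ.+ parity h       ≡⟨ cong (1ℙ ℙ.+_) h-even ⟩
    1ℙ                    ∎

  yv≢yw : yv ≢ yw
  yv≢yw refl with trans (sym s-odd) (trans (InA-walk-parity n-even v∈A (layerʷ yv∈K (proj₁ xv→c))) h-even)
  ... | ()

mainTheorem12 : (n : ℕ) → n % 2 ≡ 0 → 4 ≤ n →
    (v w : Vtx) → InA n v → InA n w →
    (Σ ℕ λ k → IsDist (CAdj n) (proj₁ v) (proj₁ w) k × k % 4 ≡ 1) →
    Σ Vtx λ s → InB n s × (Σ ℕ λ m → IsDist (PAdj n) v s m × IsDist (PAdj n) w s m)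
mainTheorem12 n n%2≡0 _ v w v∈A w∈A (k , geodesic , k%4≡1) =
  equidistant-vertex-in-B (%2≡0⇒parity≡0ℙ n n%2≡0) v∈A w∈A
    (2 * (k / 4)) (*-homo-* 2 (k / 4))
    (subst (IsDist (CAdj n) (proj₁ v) (proj₁ w)) (%4≡1⇒≡2j+[1+2j] k k%4≡1) geodesic)
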